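{- Let $\mathbb{K}$ be a field and $T$ an $n\times n$ matrix over $\mathbb{K}$. Then $T$ equals the system map $(G,A,\pi)$ of some linear SDS over a graph $G$ with vertices $v_1,\dots,v_n$ and update schedule $\pi=v_1v_2\cdots v_n$ if and only if $T$ has an LU decomposition, i.e. $T=LU$ with $L$ a lower triangular matrix all of whose diagonal entries equal $1$ and $U$ an upper triangular matrix.
   Context: A linear SDS $(G,A,\pi)$ over a field $\mathbb{K}$: $G$ is a connected simple graph with vertices $v_1,\dots,v_n$; $A=(a_{ij})$ is an $n\times n$ matrix over $\mathbb{K}$ with $a_{ij}=0$ whenever $i\neq j$ and $v_i,v_j$ are not adjacent; the local function of $v_i$ is $x_i\mapsto a_{i1}x_1+\cdots+a_{in}x_n$, inducing the matrix $F_{v_i}$ equal to the identity except that its $i$-th row is $(a_{i1},\dots,a_{in})$. For a permutation $\pi=\pi_1\cdots\pi_n$ of the vertices, the system map is $(G,A,\pi)=F_{\pi_n}\cdots F_{\pi_1}$. -}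

module Defs where

open import Level using (Level; _⊔_; suc)
open import Data.Nat using (ℕ)
open import Data.Fin using (Fin; _<_; _≟_)
open import Data.Bool using (Bool; true; false)
open import Data.List using (List; foldl; allFin)
open import Data.Product using (Σ; ∃; ∃-syntax; _×_; _,_)
open import Relation.Nullary using (¬_; yes; no)
open import Relation.Binary.PropositionalEquality using (_≡_)
open import Algebra.Bundles using (CommutativeRing)
import Algebra.Properties.Monoid.Sum as MonoidSum

record Field (c ℓ : Level) : Set (Level.suc (c ⊔ ℓ)) where
  field
    commutativeRing : CommutativeRing c ℓ
  open CommutativeRing commutativeRing public
  field
    1≉0     : ¬ (1# ≈ 0#)
    inverse : ∀ x → ¬ (x ≈ 0#) → ∃[ y ] (x * y ≈ 1#)

-- Simple graphs on the vertex set Fin n (vertex v_i is index i).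

record SimpleGraph (n : ℕ) : Set where
  field
    adj       : Fin n → Fin n → Bool
    symmetric : ∀ i j → adj i j ≡ adj j i
    irreflex  : ∀ i → adj i i ≡ false

data Walk {n : ℕ} (G : SimpleGraph n) : Fin n → Fin n → Set where
  here : ∀ {i} → Walk G i i
  step : ∀ {i j k} → SimpleGraph.adj G i j ≡ true → Walk G j k → Walk G i k

Connected : ∀ {n} → SimpleGraph n → Set
Connected {n} G = ∀ (i j : Fin n) → Walk G i j

module _ {c ℓ : Level} (K : Field c ℓ) where
  open Field K
  open MonoidSum +-monoid using (sum)

  Matrix : ℕ → Set c
  Matrix n = Fin n → Fin n → Carrier

  _≈ᴹ_ : ∀ {n} → Matrix n → Matrix n → Set ℓ
  M ≈ᴹ N = ∀ i j → M i j ≈ N i j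

  _*ᴹ_ : ∀ {n} → Matrix n → Matrix n → Matrix n
  (M *ᴹ N) i j = sum (λ k → M i k * N k j)

  identityᴹ : ∀ {n} → Matrix n
  identityᴹ i j with i ≟ j
  ... | yes _ = 1#
  ... | no  _ = 0#

  Compatible : ∀ {n} → SimpleGraph n → Matrix n → Set ℓ
  Compatible G A = ∀ i j → ¬ (i ≡ j) → SimpleGraph.adj G i j ≡ false → A i j ≈ 0#

  localMatrix : ∀ {n} → Matrix n → Fin n → Matrix n
  localMatrix A i r j with r ≟ i
  ... | yes _ = A i j
  ... | no  _ = identityᴹ r j

  -- update schedule π = π_0 π_1 ... π_{n-1} given as a function
  -- (position ↦ vertex); system map F_{π_{n-1}} ⋯ F_{π_0}.
  systemMap : ∀ {n} → Matrix n → (Fin n → Fin n) → Matrix n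
  systemMap {n} A π = foldl (λ M k → localMatrix A (π k) *ᴹ M) identityᴹ (allFin n)

  IsSDSMapIdSchedule : ∀ {n} → Matrix n → Set (c ⊔ ℓ)
  IsSDSMapIdSchedule {n} T =
    Σ (SimpleGraph n) λ G → Connected G ×
      Σ (Matrix n) λ A → Compatible G A × (T ≈ᴹ systemMap A (λ k → k))

  LowerUnitriangular : ∀ {n} → Matrix n → Set ℓ
  LowerUnitriangular L = (∀ i j → i < j → L i j ≈ 0#) × (∀ i → L i i ≈ 1#)

  UpperTriangular : ∀ {n} → Matrix n → Set ℓ
  UpperTriangular U = ∀ i j → j < i → U i j ≈ 0#

  HasLU : ∀ {n} → Matrix n → Set (c ⊔ ℓ)
  HasLU T = Σ (Matrix _) λ L → Σ (Matrix _) λ U →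
    LowerUnitriangular L × UpperTriangular U × (T ≈ᴹ (L *ᴹ U))

module Submission where

-- Write S↓ for the strictly lower triangular part of a matrix S.  The key
-- fact (systemMap-solves) is that the update F_{v_k} rewrites row k of the
-- state using rows j < k, which are already final, and rows j ≥ k, which
-- are still rows of I; hence the system map X of A solves the triangular
-- system  X = U_A + A↓ X,  with U_A the upper triangular part of A.  Such
-- systems X = B + S↓ X have at most one solution (row induction), and for
-- B upper triangular the system map of the matrix with strict lower part
-- S↓ and upper part B is one.
--   (⇒)  L solving L = I + A↓ L is lower unitriangular, and L U_A solves
--        the system of A, so by uniqueness T = L U_A.
--   (⇐)  With N a lower unitriangular left inverse of L (built from right
--        inverses, which are again solutions of triangular systems),
--        L U solves X = U + (-N)↓ X; so T is the system map of the matrix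
--        with strict lower part (-N)↓ and upper part U, on the complete graph.

open import Defs
open import Level using (Level)
open import Data.Nat using (ℕ)
open import Data.Product using (_×_)

import Data.Nat as ℕ
import Data.Nat.Properties as ℕ
open import Data.Bool using (true; false; not)
open import Data.Empty using (⊥-elim)
open import Data.Fin using (Fin; zero; suc; toℕ; _<_; _≟_; _<?_)
import Data.Fin.Properties as Fin
open import Data.Fin.Induction using (<-wellFounded)
open import Data.List using (foldl; tabulate)
open import Data.Product using (∃-syntax; _,_; proj₁; proj₂)
open import Data.Sum using (_⊎_; inj₁; inj₂; map₂)
open import Function using (_∘_; id)
open import Induction.WellFounded using (module All)
open import Relation.Nullary using (Dec; yes; no; does)
open import Relation.Binary.Bundles using (Setoid)
open import Relation.Binary.PropositionalEquality as ≡ using (_≡_; _≢_)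
import Algebra.Properties.Group as GroupProperties
import Algebra.Properties.Semiring.Sum as SemiringSum
import Relation.Binary.Reasoning.Setoid as SetoidReasoning

foldl-invariant : ∀ {a p n} {B : Set a} (P : ℕ → B → Set p) (f : B → Fin n → B) →
  (∀ k x b → toℕ x ≡ k → P k b → P (ℕ.suc k) (f b x)) →
  ∀ {m} (g : Fin m → Fin n) k b → (∀ i → toℕ (g i) ≡ k ℕ.+ toℕ i) →
  P k b → P (k ℕ.+ m) (foldl f b (tabulate g))
foldl-invariant P f advance {ℕ.zero} g k b positions Pkb =
  ≡.subst (λ j → P j b) (≡.sym (ℕ.+-identityʳ k)) Pkb
foldl-invariant P f advance {ℕ.suc m} g k b positions Pkb =
  ≡.subst (λ j → P j (foldl f (f b (g zero)) (tabulate (g ∘ suc)))) (≡.sym (ℕ.+-suc k m))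
    (foldl-invariant P f advance (g ∘ suc) (ℕ.suc k) (f b (g zero))
      (λ i → ≡.trans (positions (suc i)) (ℕ.+-suc k (toℕ i)))
      (advance k (g zero) b (≡.trans (positions zero) (ℕ.+-identityʳ k)) Pkb))

row-induction : ∀ {p n} (P : Fin n → Set p) →
  (∀ r → (∀ j → j < r → P j) → P r) → ∀ r → P r
row-induction {p} P induct = All.wfRec <-wellFounded p P (λ r earlier → induct r (λ j → earlier))

-- The complete graph K_n: it is connected and imposes no compatibility
-- condition on A, so it can carry any local functions.
completeGraph : ∀ n → SimpleGraph n
completeGraph n = record { adj = λ i j → not (does (i ≟ j)) ; symmetric = symmetric ; irreflex = irreflex }
  where
  symmetric : ∀ i j → not (does (i ≟ j)) ≡ not (does (j ≟ i))
  symmetric i j with i ≟ j | j ≟ i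
  ... | yes _   | yes _   = ≡.refl
  ... | no _    | no _    = ≡.refl
  ... | yes i≡j | no j≢i  = ⊥-elim (j≢i (≡.sym i≡j))
  ... | no i≢j  | yes j≡i = ⊥-elim (i≢j (≡.sym j≡i))
  irreflex : ∀ i → not (does (i ≟ i)) ≡ false
  irreflex i with i ≟ i
  ... | yes _   = ≡.refl
  ... | no i≢i  = ⊥-elim (i≢i ≡.refl)

complete-adjacent : ∀ {n} (i j : Fin n) → i ≢ j → SimpleGraph.adj (completeGraph n) i j ≡ true
complete-adjacent i j i≢j with i ≟ j
... | yes i≡j = ⊥-elim (i≢j i≡j)
... | no _    = ≡.refl

complete-connected : ∀ n → Connected (completeGraph n)
complete-connected n i j with i ≟ j
... | yes ≡.refl = here
... | no i≢j     = step (complete-adjacent i j i≢j) here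

module LinearSDS {c ℓ : Level} (K : Field c ℓ) where
  open Field K hiding (zero)
  open SemiringSum semiring
    using (sum; sum-cong-≋; sum-replicate-zero; ∑-distrib-+; ∑-comm; *-distribʳ-sum; *-distribˡ-sum)
  open GroupProperties +-group using () renaming (∙-cancelʳ to +-cancelʳ)
  module ≈-Reasoning = SetoidReasoning setoid

  Mat : ℕ → Set c
  Mat = Matrix K

  infixl 7 _⊗_
  infixl 6 _⊕_
  infix 4 _≋_

  _⊗_ : ∀ {n} → Mat n → Mat n → Mat n
  _⊗_ = _*ᴹ_ K

  _⊕_ : ∀ {n} → Mat n → Mat n → Mat n
  (M ⊕ N) i j = M i j + N i j

  _≋_ : ∀ {n} → Mat n → Mat n → Set ℓ
  _≋_ = _≈ᴹ_ K

  I : ∀ {n} → Mat n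
  I = identityᴹ K

  zeroᴹ : ∀ {n} → Mat n
  zeroᴹ _ _ = 0#

  negᴹ : ∀ {n} → Mat n → Mat n
  negᴹ M i j = - M i j

  ≋-setoid : ℕ → Setoid c ℓ
  ≋-setoid n = record
    { Carrier       = Mat n
    ; _≈_           = _≋_
    ; isEquivalence = record
      { refl  = λ i j → refl
      ; sym   = λ M≋N i j → sym (M≋N i j)
      ; trans = λ M≋N N≋P i j → trans (M≋N i j) (N≋P i j)
      }
    }

  module ≋ {n : ℕ} = Setoid (≋-setoid n)
  module ≋-Reasoning {n : ℕ} = SetoidReasoning (≋-setoid n)

  sum-delta : ∀ {n} (f : Fin n → Carrier) i → (∀ k → k ≢ i → f k ≈ 0#) → sum f ≈ f i
  sum-delta {ℕ.suc n} f zero vanish =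
    trans (+-congˡ (trans (sum-cong-≋ (λ k → vanish (suc k) (λ ())))
                          (sum-replicate-zero n)))
          (+-identityʳ _)
  sum-delta {ℕ.suc n} f (suc i) vanish =
    trans (+-cong (vanish zero (λ ()))
                  (sum-delta (f ∘ suc) i (λ k k≢i → vanish (suc k) (k≢i ∘ Fin.suc-injective))))
          (+-identityˡ _)

  I-diag : ∀ {n} (i : Fin n) → I i i ≈ 1#
  I-diag i with i ≟ i
  ... | yes _   = refl
  ... | no i≢i  = ⊥-elim (i≢i ≡.refl)

  I-off : ∀ {n} (i j : Fin n) → i ≢ j → I i j ≈ 0#
  I-off i j i≢j with i ≟ j
  ... | yes i≡j = ⊥-elim (i≢j i≡j)
  ... | no _    = refl

  I-upper : ∀ {n} → UpperTriangular K (I {n})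
  I-upper i j j<i = I-off i j (λ i≡j → Fin.<⇒≢ j<i (≡.sym i≡j))

  ⊗-cong : ∀ {n} {M M′ N N′ : Mat n} → M ≋ M′ → N ≋ N′ → M ⊗ N ≋ M′ ⊗ N′
  ⊗-cong M≋M′ N≋N′ i j = sum-cong-≋ (λ k → *-cong (M≋M′ i k) (N≋N′ k j))

  ⊕-cong : ∀ {n} {M M′ N N′ : Mat n} → M ≋ M′ → N ≋ N′ → M ⊕ N ≋ M′ ⊕ N′
  ⊕-cong M≋M′ N≋N′ i j = +-cong (M≋M′ i j) (N≋N′ i j)

  ⊕-cancelʳ : ∀ {n} {M N P : Mat n} → M ⊕ P ≋ N ⊕ P → M ≋ N
  ⊕-cancelʳ {P = P} eq i j = +-cancelʳ (P i j) _ _ (eq i j)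

  ⊗-assoc : ∀ {n} (M N P : Mat n) → (M ⊗ N) ⊗ P ≋ M ⊗ (N ⊗ P)
  ⊗-assoc M N P i j = begin
    sum (λ k → sum (λ l → M i l * N l k) * P k j)
      ≈⟨ sum-cong-≋ (λ k → *-distribʳ-sum (P k j) (λ l → M i l * N l k)) ⟩
    sum (λ k → sum (λ l → M i l * N l k * P k j))
      ≈⟨ ∑-comm (λ k l → M i l * N l k * P k j) ⟩
    sum (λ l → sum (λ k → M i l * N l k * P k j))
      ≈⟨ sum-cong-≋ (λ l → sum-cong-≋ (λ k → *-assoc (M i l) (N l k) (P k j))) ⟩
    sum (λ l → sum (λ k → M i l * (N l k * P k j)))
      ≈⟨ sum-cong-≋ (λ l → *-distribˡ-sum (M i l) (λ k → N l k * P k j)) ⟨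
    sum (λ l → M i l * sum (λ k → N l k * P k j)) ∎
    where open ≈-Reasoning

  ⊗-distribʳ : ∀ {n} (M N P : Mat n) → (M ⊕ N) ⊗ P ≋ M ⊗ P ⊕ N ⊗ P
  ⊗-distribʳ M N P i j =
    trans (sum-cong-≋ (λ k → distribʳ (P k j) (M i k) (N i k)))
          (∑-distrib-+ (λ k → M i k * P k j) (λ k → N i k * P k j))

  ⊗-identityˡ : ∀ {n} (M : Mat n) → I ⊗ M ≋ M
  ⊗-identityˡ M i j =
    trans (sum-delta (λ k → I i k * M k j) i
             (λ k k≢i → trans (*-congʳ (I-off i k (k≢i ∘ ≡.sym))) (zeroˡ _)))
          (trans (*-congʳ (I-diag i)) (*-identityˡ _))

  ⊗-identityʳ : ∀ {n} (M : Mat n) → M ⊗ I ≋ M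
  ⊗-identityʳ M i j =
    trans (sum-delta (λ k → M i k * I k j) j
             (λ k k≢j → trans (*-congˡ (I-off k j k≢j)) (zeroʳ _)))
          (trans (*-congˡ (I-diag j)) (*-identityʳ _))

  ⊗-zeroʳ : ∀ {n} (M : Mat n) → M ⊗ zeroᴹ ≋ zeroᴹ
  ⊗-zeroʳ {n} M i j = trans (sum-cong-≋ (λ k → zeroʳ (M i k))) (sum-replicate-zero n)

  ⊗-row-cong : ∀ {n} (T X Y : Mat n) r c →
    (∀ j → T r j ≈ 0# ⊎ X j c ≈ Y j c) → (T ⊗ X) r c ≈ (T ⊗ Y) r c
  ⊗-row-cong T X Y r c relevant = sum-cong-≋ term
    where
    term : ∀ j → T r j * X j c ≈ T r j * Y j c
    term j with relevant j
    ... | inj₁ Trj≈0 = trans (*-congʳ Trj≈0) (trans (zeroˡ _) (sym (trans (*-congʳ Trj≈0) (zeroˡ _))))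
    ... | inj₂ Xjc≈Yjc = *-congˡ Xjc≈Yjc

  splice : ∀ {n} → Mat n → Mat n → Mat n
  splice S B i j = below? (j <? i) (S i j) (B i j)
    where
    below? : Dec (j < i) → Carrier → Carrier → Carrier
    below? (yes _) s b = s
    below? (no _)  s b = b

  strictLower : ∀ {n} → Mat n → Mat n
  strictLower A = splice A zeroᴹ

  upper : ∀ {n} → Mat n → Mat n
  upper A = splice zeroᴹ A

  upper-upperTriangular : ∀ {n} (A : Mat n) → UpperTriangular K (upper A)
  upper-upperTriangular A i j j<i with j <? i
  ... | yes _    = refl
  ... | no j≮i   = ⊥-elim (j≮i j<i)

  upper-support : ∀ {n} (A : Mat n) i j → upper A i j ≈ 0# ⊎ toℕ i ℕ.≤ toℕ j
  upper-support A i j with j <? i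
  ... | yes _    = inj₁ refl
  ... | no j≮i   = inj₂ (ℕ.≮⇒≥ j≮i)

  strictLower-support : ∀ {n} (A : Mat n) i j → strictLower A i j ≈ 0# ⊎ j < i
  strictLower-support A i j with j <? i
  ... | yes j<i  = inj₂ j<i
  ... | no _     = inj₁ refl

  upper+strictLower : ∀ {n} (A : Mat n) → A ≋ upper A ⊕ strictLower A
  upper+strictLower A i j with j <? i
  ... | yes _    = sym (+-identityˡ _)
  ... | no _     = sym (+-identityʳ _)

  strictLower-splice : ∀ {n} (S B : Mat n) → strictLower (splice S B) ≋ strictLower S
  strictLower-splice S B i j with j <? i
  ... | yes _    = refl
  ... | no _     = refl

  upper-splice : ∀ {n} (S B : Mat n) → UpperTriangular K B → upper (splice S B) ≋ B
  upper-splice S B upB i j with j <? i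
  ... | yes j<i  = sym (upB i j j<i)
  ... | no _     = refl

  lowerUnitriangular-complement : ∀ {n} (L : Mat n) → LowerUnitriangular K L →
    L ⊕ strictLower (negᴹ L) ≋ I
  lowerUnitriangular-complement L (aboveZero , diagOne) i j with j <? i
  ... | yes j<i = trans (-‿inverseʳ (L i j)) (sym (I-upper i j j<i))
  ... | no j≮i with i ≟ j
  ...   | yes ≡.refl = trans (+-identityʳ _) (diagOne i)
  ...   | no i≢j     =
    trans (+-identityʳ _) (aboveZero i j (ℕ.≤∧≢⇒< (ℕ.≮⇒≥ j≮i) (i≢j ∘ Fin.toℕ-injective)))

  strictLower-row-cong : ∀ {n} (S X Y : Mat n) r c → (∀ j → j < r → X j c ≈ Y j c) →
    (strictLower S ⊗ X) r c ≈ (strictLower S ⊗ Y) r c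
  strictLower-row-cong S X Y r c above =
    ⊗-row-cong (strictLower S) X Y r c (λ j → map₂ (above j) (strictLower-support S r j))

  Solves : ∀ {n} → Mat n → Mat n → Mat n → Set ℓ
  Solves S B X = X ≋ B ⊕ strictLower S ⊗ X

  -- Triangular systems have at most one solution: row r of a solution is
  -- determined by B and the rows above it.
  solution-unique : ∀ {n} {S B X Y : Mat n} → Solves S B X → Solves S B Y → X ≋ Y
  solution-unique {S = S} {B} {X} {Y} solX solY =
    row-induction (λ r → ∀ c → X r c ≈ Y r c) rowsAgree
    where
    rowsAgree : ∀ r → (∀ j → j < r → ∀ c → X j c ≈ Y j c) → ∀ c → X r c ≈ Y r c
    rowsAgree r above c = begin
      X r c                            ≈⟨ solX r c ⟩
      B r c + (strictLower S ⊗ X) r c  ≈⟨ +-congˡ (strictLower-row-cong S X Y r c (λ j j<r → above j j<r c)) ⟩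
      B r c + (strictLower S ⊗ Y) r c  ≈⟨ solY r c ⟨
      Y r c                            ∎
      where open ≈-Reasoning

  solution-lowerUnitriangular : ∀ {n} {S X : Mat n} → Solves S I X → LowerUnitriangular K X
  solution-lowerUnitriangular {S = S} {X} solX = aboveDiagonal , diagonal
    where
    S↓X-vanishes : ∀ r c → (∀ j → j < r → X j c ≈ 0#) → (strictLower S ⊗ X) r c ≈ 0#
    S↓X-vanishes r c above =
      trans (strictLower-row-cong S X zeroᴹ r c above) (⊗-zeroʳ (strictLower S) r c)

    rowAbove : ∀ r → (∀ j → j < r → ∀ c → j < c → X j c ≈ 0#) → ∀ c → r < c → X r c ≈ 0#
    rowAbove r above c r<c =
      trans (solX r c)
            (trans (+-cong (I-off r c (Fin.<⇒≢ r<c))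
                           (S↓X-vanishes r c (λ j j<r → above j j<r c (Fin.<-trans j<r r<c))))
                   (+-identityʳ 0#))

    aboveDiagonal : ∀ i j → i < j → X i j ≈ 0#
    aboveDiagonal = row-induction (λ r → ∀ c → r < c → X r c ≈ 0#) rowAbove

    diagonal : ∀ i → X i i ≈ 1#
    diagonal i =
      trans (solX i i)
            (trans (+-cong (I-diag i) (S↓X-vanishes i i (λ j j<i → aboveDiagonal j i j<i)))
                   (+-identityʳ 1#))

  module Updates {n : ℕ} (A : Mat n) where

    F : Fin n → Mat n
    F = localMatrix K A

    update-other : ∀ x (M : Mat n) r c → r ≢ x → (F x ⊗ M) r c ≈ M r c
    update-other x M r c r≢x = trans (sum-cong-≋ (λ j → *-congʳ (rowOfI j))) (⊗-identityˡ M r c)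
      where
      rowOfI : ∀ j → F x r j ≈ I r j
      rowOfI j with r ≟ x
      ... | yes r≡x = ⊥-elim (r≢x r≡x)
      ... | no _    = refl

    update-self : ∀ x (M : Mat n) c → (F x ⊗ M) x c ≈ (A ⊗ M) x c
    update-self x M c = sum-cong-≋ (λ j → *-congʳ (rowOfA j))
      where
      rowOfA : ∀ j → F x x j ≈ A x j
      rowOfA j with x ≟ x
      ... | yes _   = refl
      ... | no x≢x  = ⊥-elim (x≢x ≡.refl)

    updated-row : ∀ x (M : Mat n) → (∀ j c → toℕ x ℕ.≤ toℕ j → M j c ≈ I j c) →
      ∀ c → (F x ⊗ M) x c ≈ (upper A ⊕ strictLower A ⊗ (F x ⊗ M)) x c
    updated-row x M rowsOfI c = begin
      (F x ⊗ M) x c                                     ≈⟨ update-self x M c ⟩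
      (A ⊗ M) x c                                       ≈⟨ ⊗-cong (upper+strictLower A) (≋.refl {x = M}) x c ⟩
      ((upper A ⊕ strictLower A) ⊗ M) x c               ≈⟨ ⊗-distribʳ (upper A) (strictLower A) M x c ⟩
      (upper A ⊗ M) x c + (strictLower A ⊗ M) x c       ≈⟨ +-cong (⊗-row-cong (upper A) M I x c upperRows)
                                                                  (strictLower-row-cong A M (F x ⊗ M) x c rowsAbove) ⟩
      (upper A ⊗ I) x c + (strictLower A ⊗ (F x ⊗ M)) x c ≈⟨ +-congʳ (⊗-identityʳ (upper A) x c) ⟩
      upper A x c + (strictLower A ⊗ (F x ⊗ M)) x c     ∎
      where
      open ≈-Reasoning
      upperRows : ∀ j → upper A x j ≈ 0# ⊎ M j c ≈ I j c
      upperRows j = map₂ (rowsOfI j c) (upper-support A x j)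
      rowsAbove : ∀ j → j < x → M j c ≈ (F x ⊗ M) j c
      rowsAbove j j<x = sym (update-other x M j c (Fin.<⇒≢ j<x))

    RowInvariant : ℕ → Mat n → Fin n → Fin n → Set ℓ
    RowInvariant k M r c = (toℕ r ℕ.< k → M r c ≈ (upper A ⊕ strictLower A ⊗ M) r c)
                         × (k ℕ.≤ toℕ r → M r c ≈ I r c)

    Invariant : ℕ → Mat n → Set ℓ
    Invariant k M = ∀ r c → RowInvariant k M r c

    invariant-updated-row : ∀ k x (M : Mat n) → toℕ x ≡ k → Invariant k M →
      ∀ c → RowInvariant (ℕ.suc k) (F x ⊗ M) x c
    invariant-updated-row k x M x≡k inv c =
      (λ _ → updated-row x M (λ j c′ x≤j → proj₂ (inv j c′) (≡.subst (ℕ._≤ toℕ j) x≡k x≤j)) c) ,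
      (λ k<x → ⊥-elim (ℕ.<-irrefl (≡.sym x≡k) k<x))

    invariant-other-row : ∀ k x (M : Mat n) → toℕ x ≡ k → Invariant k M →
      ∀ r c → r ≢ x → RowInvariant (ℕ.suc k) (F x ⊗ M) r c
    invariant-other-row k x M x≡k inv r c r≢x = earlierRow , laterRow
      where
      open ≈-Reasoning
      earlierRow : toℕ r ℕ.< ℕ.suc k → (F x ⊗ M) r c ≈ (upper A ⊕ strictLower A ⊗ (F x ⊗ M)) r c
      earlierRow r<1+k = begin
        (F x ⊗ M) r c                                 ≈⟨ update-other x M r c r≢x ⟩
        M r c                                         ≈⟨ proj₁ (inv r c) r<k ⟩
        upper A r c + (strictLower A ⊗ M) r c         ≈⟨ +-congˡ (strictLower-row-cong A M (F x ⊗ M) r c rowsAbove) ⟩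
        upper A r c + (strictLower A ⊗ (F x ⊗ M)) r c ∎
        where
        r<k : toℕ r ℕ.< k
        r<k = ℕ.≤∧≢⇒< (ℕ.≤-pred r<1+k) (λ r≡k → r≢x (Fin.toℕ-injective (≡.trans r≡k (≡.sym x≡k))))
        rowsAbove : ∀ j → j < r → M j c ≈ (F x ⊗ M) j c
        rowsAbove j j<r = sym (update-other x M j c
          (λ j≡x → ℕ.<-irrefl (≡.trans (≡.cong toℕ j≡x) x≡k) (ℕ.<-trans j<r r<k)))
      laterRow : ℕ.suc k ℕ.≤ toℕ r → (F x ⊗ M) r c ≈ I r c
      laterRow k<r = trans (update-other x M r c r≢x) (proj₂ (inv r c) (ℕ.<⇒≤ k<r))

    invariant-step : ∀ k x (M : Mat n) → toℕ x ≡ k → Invariant k M →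
      Invariant (ℕ.suc k) (F x ⊗ M)
    invariant-step k x M x≡k inv r c = byRow (r ≟ x)
      where
      byRow : Dec (r ≡ x) → RowInvariant (ℕ.suc k) (F x ⊗ M) r c
      byRow (yes r≡x) = ≡.subst (λ r′ → RowInvariant (ℕ.suc k) (F x ⊗ M) r′ c) (≡.sym r≡x)
                                (invariant-updated-row k x M x≡k inv c)
      byRow (no r≢x)  = invariant-other-row k x M x≡k inv r c r≢x

  systemMap-solves : ∀ {n} (A : Mat n) → Solves A (upper A) (systemMap K A (λ k → k))
  systemMap-solves {n} A r c = proj₁ (afterAllUpdates r c) (Fin.toℕ<n r)
    where
    open Updates A
    afterAllUpdates : Invariant n (systemMap K A (λ k → k))
    afterAllUpdates =
      foldl-invariant Invariant (λ M x → F x ⊗ M) invariant-step id 0 I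
        (λ _ → ≡.refl) (λ r c → (λ ()) , (λ _ → refl))

  splice-solves : ∀ {n} (S B : Mat n) → UpperTriangular K B →
    Solves S B (systemMap K (splice S B) (λ k → k))
  splice-solves S B upB = begin
    X                                                 ≈⟨ systemMap-solves (splice S B) ⟩
    upper (splice S B) ⊕ strictLower (splice S B) ⊗ X ≈⟨ ⊕-cong (upper-splice S B upB)
                                                                (⊗-cong (strictLower-splice S B) ≋.refl) ⟩
    B ⊕ strictLower S ⊗ X                             ∎
    where
    open ≋-Reasoning
    X = systemMap K (splice S B) (λ k → k)

  -- Lower unitriangular matrices have lower unitriangular right inverses:
  -- L N = I  iff  N = I + (-L)↓ N, a triangular system.
  rightInverse : ∀ {n} (L : Mat n) → LowerUnitriangular K L →
    ∃[ N ] (LowerUnitriangular K N × L ⊗ N ≋ I)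
  rightInverse L lowL = N , solution-lowerUnitriangular solN , ⊕-cancelʳ LN+S↓N≋I+S↓N
    where
    open ≋-Reasoning
    S = negᴹ L
    N = systemMap K (splice S I) (λ k → k)
    solN : Solves S I N
    solN = splice-solves S I I-upper
    LN+S↓N≋I+S↓N : L ⊗ N ⊕ strictLower S ⊗ N ≋ I ⊕ strictLower S ⊗ N
    LN+S↓N≋I+S↓N = begin
      L ⊗ N ⊕ strictLower S ⊗ N  ≈⟨ ⊗-distribʳ L (strictLower S) N ⟨
      (L ⊕ strictLower S) ⊗ N    ≈⟨ ⊗-cong (lowerUnitriangular-complement L lowL) ≋.refl ⟩
      I ⊗ N                      ≈⟨ ⊗-identityˡ N ⟩
      N                          ≈⟨ solN ⟩
      I ⊕ strictLower S ⊗ N      ∎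

  leftInverse : ∀ {n} (L : Mat n) → LowerUnitriangular K L →
    ∃[ N ] (LowerUnitriangular K N × N ⊗ L ≋ I)
  leftInverse L lowL with rightInverse L lowL
  ... | N , lowN , LN≋I with rightInverse N lowN
  ... | P , _ , NP≋I = N , lowN , NL≋I
    where
    open ≋-Reasoning
    NL≋I : N ⊗ L ≋ I
    NL≋I = begin
      N ⊗ L               ≈⟨ ⊗-identityʳ (N ⊗ L) ⟨
      N ⊗ L ⊗ I           ≈⟨ ⊗-cong ≋.refl NP≋I ⟨
      N ⊗ L ⊗ (N ⊗ P)     ≈⟨ ⊗-assoc N L (N ⊗ P) ⟩
      N ⊗ (L ⊗ (N ⊗ P))   ≈⟨ ⊗-cong ≋.refl (⊗-assoc L N P) ⟨
      N ⊗ (L ⊗ N ⊗ P)     ≈⟨ ⊗-cong ≋.refl (⊗-cong LN≋I ≋.refl) ⟩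
      N ⊗ (I ⊗ P)         ≈⟨ ⊗-cong ≋.refl (⊗-identityˡ P) ⟩
      N ⊗ P               ≈⟨ NP≋I ⟩
      I                   ∎

  everyMatrix-compatible : ∀ {n} (A : Mat n) → Compatible K (completeGraph n) A
  everyMatrix-compatible A i j i≢j nonadjacent
    with ≡.trans (≡.sym (complete-adjacent i j i≢j)) nonadjacent
  ... | ()

  sds⇒LU : ∀ {n} (T : Mat n) → IsSDSMapIdSchedule K T → HasLU K T
  sds⇒LU T (_ , _ , A , _ , T≋X) =
    L , upper A , solution-lowerUnitriangular solL , upper-upperTriangular A ,
    ≋.trans T≋X (solution-unique (systemMap-solves A) LU-solves)
    where
    open ≋-Reasoning
    L = systemMap K (splice A I) (λ k → k)
    solL : Solves A I L
    solL = splice-solves A I I-upper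
    LU-solves : Solves A (upper A) (L ⊗ upper A)
    LU-solves = begin
      L ⊗ upper A                                    ≈⟨ ⊗-cong solL ≋.refl ⟩
      (I ⊕ strictLower A ⊗ L) ⊗ upper A              ≈⟨ ⊗-distribʳ I (strictLower A ⊗ L) (upper A) ⟩
      I ⊗ upper A ⊕ strictLower A ⊗ L ⊗ upper A      ≈⟨ ⊕-cong (⊗-identityˡ (upper A))
                                                               (⊗-assoc (strictLower A) L (upper A)) ⟩
      upper A ⊕ strictLower A ⊗ (L ⊗ upper A)        ∎

  LU⇒sds : ∀ {n} (T : Mat n) → HasLU K T → IsSDSMapIdSchedule K T
  LU⇒sds {n} T (L , U , lowL , upU , T≋LU) with leftInverse L lowL
  ... | N , lowN , NL≋I =
    completeGraph n , complete-connected n , splice S U , everyMatrix-compatible (splice S U) ,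
    ≋.trans T≋LU (solution-unique LU-solves (splice-solves S U upU))
    where
    open ≋-Reasoning
    S = negᴹ N
    LU-solves : Solves S U (L ⊗ U)
    LU-solves = begin
      L ⊗ U                                  ≈⟨ ⊗-identityˡ (L ⊗ U) ⟨
      I ⊗ (L ⊗ U)                            ≈⟨ ⊗-cong (lowerUnitriangular-complement N lowN) ≋.refl ⟨
      (N ⊕ strictLower S) ⊗ (L ⊗ U)          ≈⟨ ⊗-distribʳ N (strictLower S) (L ⊗ U) ⟩
      N ⊗ (L ⊗ U) ⊕ strictLower S ⊗ (L ⊗ U)  ≈⟨ ⊕-cong (⊗-assoc N L U) ≋.refl ⟨
      N ⊗ L ⊗ U ⊕ strictLower S ⊗ (L ⊗ U)    ≈⟨ ⊕-cong (⊗-cong NL≋I ≋.refl) ≋.refl ⟩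
      I ⊗ U ⊕ strictLower S ⊗ (L ⊗ U)        ≈⟨ ⊕-cong (⊗-identityˡ U) ≋.refl ⟩
      U ⊕ strictLower S ⊗ (L ⊗ U)            ∎

corollary1 : ∀ {c ℓ : Level} (K : Field c ℓ) (n : ℕ) (T : Matrix K n) →
    (IsSDSMapIdSchedule K T → HasLU K T) × (HasLU K T → IsSDSMapIdSchedule K T)
corollary1 K n T = LinearSDS.sds⇒LU K T , LinearSDS.LU⇒sds K T
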